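{- For every positive integer $k$, $o([Ao^{3k}A],B)=\mathcal{D}$.
   Context: Maker-Maker domination game: on a finite simple graph $G$, Alice and Bob alternately claim previously unclaimed vertices; the first player whose claimed vertices form a dominating set of $G$ wins; if all vertices are claimed and nobody dominates, it is a draw. A position is $P=(G,V_A,V_B)$ with $V_A\cap V_B=\emptyset$ the vertices already claimed by Alice and Bob. For $t\in\{A,B\}$, $o(P,t)=\mathcal{A}$ if, with player $t$ to move from $P$, Alice has a strategy guaranteeing that her claimed vertices (including $V_A$) dominate $G$ before Bob's (including $V_B$) do; otherwise $o(P,t)=\mathcal{D}$ (including the case where Bob dominates first). For $X,Y\in\{A,B\}$ and $n\ge 0$, the bounded path $[Xo^nY]$ is the position on the path $v_{ -1}v_0v_1\cdots v_nv_{n+1}v_{n+2}$ in which exactly $v_1,\dots,v_n$ are unclaimed, $v_0$ is claimed by player $X$ and $v_{ -1}$ by the other player, and $v_{n+1}$ is claimed by player $Y$ and $v_{n+2}$ by the other player. -}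

module Defs where

open import Data.Nat using (ℕ; zero; suc; _+_; _≡ᵇ_)
open import Data.Fin using (Fin; toℕ; _≟_)
open import Data.Bool using (if_then_else_)
open import Data.Product using (∃; _×_)
open import Data.Sum using (_⊎_)
open import Relation.Nullary using (¬_; does)
open import Relation.Binary.PropositionalEquality using (_≡_)

record Graph (m : ℕ) : Set₁ where
  field
    Adj   : Fin m → Fin m → Set
    sym   : ∀ {u v} → Adj u v → Adj v u
    irrefl : ∀ {u} → ¬ Adj u u
open Graph public

data Player : Set where
  A B : Player

other : Player → Player
other A = B
other B = A

data Cell : Set where
  free : Cell
  own  : Player → Cell

Config : ℕ → Set
Config m = Fin m → Cell

Owned : ∀ {m} → Config m → Player → Fin m → Set
Owned c p v = c v ≡ own p

Dominates : ∀ {m} → Graph m → (Fin m → Set) → Set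
Dominates G S = ∀ u → S u ⊎ ∃ λ w → Adj G u w × S w

claim : ∀ {m} → Config m → Fin m → Player → Config m
claim c v p u = if does (u ≟ v) then own p else c u

-- AliceWins G c t : with player t to move from configuration c, Alice has a
-- strategy guaranteeing that her claimed vertices dominate G before Bob's do.
-- (Inductive = finite game tree; no moves available means draw, not a win.)
data AliceWins {m} (G : Graph m) : Config m → Player → Set where
  aliceMove : ∀ {c} v → c v ≡ free →
    (Dominates G (Owned (claim c v A) A) ⊎ AliceWins G (claim c v A) B) →
    AliceWins G c A
  bobMove : ∀ {c} → (∃ λ v → c v ≡ free) →
    (∀ v → c v ≡ free →
       ¬ Dominates G (Owned (claim c v B) B) × AliceWins G (claim c v B) A) →
    AliceWins G c B


PathAdj : ∀ {m} → Fin m → Fin m → Set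
PathAdj i j = suc (toℕ i) ≡ toℕ j ⊎ suc (toℕ j) ≡ toℕ i

pathGraph : (m : ℕ) → Graph m
pathGraph m = record { Adj = PathAdj ; sym = symP ; irrefl = irr }
  where
  open import Data.Sum using (inj₁; inj₂)
  open import Data.Nat.Properties using (1+n≢n)
  symP : ∀ {u v} → PathAdj {m} u v → PathAdj v u
  symP (inj₁ e) = inj₂ e
  symP (inj₂ e) = inj₁ e
  irr : ∀ {u} → ¬ PathAdj {m} u u
  irr (inj₁ e) = 1+n≢n e
  irr (inj₂ e) = 1+n≢n e

-- Bounded path [X o^n Y] on v_{-1} v_0 v_1 ... v_n v_{n+1} v_{n+2};
-- vertex index i : Fin (n + 4) represents v_{i-1}.
boundedCell : Player → ℕ → Player → ℕ → Cell
boundedCell X n Y zero = own (other X)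
boundedCell X n Y (suc zero) = own X
boundedCell X n Y (suc (suc j)) =
  if j ≡ᵇ n then own Y else (if j ≡ᵇ suc n then own (other Y) else free)

boundedPath : (X : Player) (n : ℕ) (Y : Player) → Config (n + 4)
boundedPath X n Y i = boundedCell X n Y (toℕ i)

-- Bob sweeps the path from left to right.  In a frontier position every cell up to g is
-- dominated by Bob, the next L cells are free and the path ends with Alice's cell and Bob's,
-- so claiming the middle of the next three free cells advances the frontier by three.  From
-- L = 3k Bob claims the second free cell (the third if he owns g), and every answer of Alice
-- either lets him restore, possibly after a forcing threat, a frontier with L ≡ 0 mod 3 or one
-- with L ≡ 1 mod 3 whose cell g is his, or gives him a double threat to own three consecutive
-- cells, whose middle Alice can then never dominate.  The remaining answers leave three cells
-- without an Alice cell behind the frontier: Alice cannot dominate while Bob completes his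
-- sweep, and a free cell behind the frontier serves Bob as a spare move.
module Submission where

open import Defs hiding (sym)
open import Data.Nat using (ℕ; zero; suc; _+_; _∸_; _*_; _≤_; _<_; z≤n; s≤s; _≟_; _<?_; _≤?_)
open import Data.Nat.Properties
  using (≤-refl; ≤-trans; ≤-pred; ≤-antisym; ≤-<-trans; <⇒≤; n≤1+n; <⇒≢; >⇒≢; ≰⇒>; ≤∧≢⇒<;
         1+n≢n; m≤n+m; +-monoˡ-≤; +-cancelʳ-<; +-identityʳ; +-assoc; +-comm; +-suc; *-comm;
         suc-injective; m∸n+n≡m)
open import Data.Fin using (Fin; zero; suc; toℕ; fromℕ<) renaming (_≟_ to _≟ᶠ_)
open import Data.Fin.Properties using (toℕ<n; fromℕ<-toℕ; toℕ-fromℕ<)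
open import Data.Sum using (_⊎_; inj₁; inj₂; [_,_]′; map₁)
open import Data.Product using (∃; _×_; _,_; uncurry)
open import Data.Empty using (⊥; ⊥-elim)
open import Function using (_∘_)
open import Relation.Nullary using (¬_; yes; no)
open import Relation.Nullary.Decidable using (True; toWitness; dec-true; dec-false)
open import Relation.Binary.PropositionalEquality using (_≡_; _≢_; refl; sym; trans; cong; subst; ≢-sym)

≤-offset : ∀ a b {g} → {True (a ≤? b)} → a + g ≤ b + g
≤-offset a b {g} {a≤b} = +-monoˡ-≤ g (toWitness a≤b)

<⇒∃-suc-+ : ∀ {g i} → g < i → ∃ λ j → i ≡ suc (j + g)
<⇒∃-suc-+ {g} {suc i} (s≤s g≤i) = i ∸ g , cong suc (sym (m∸n+n≡m g≤i))

module PathGame (N : ℕ) where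

  G : Graph N
  G = pathGraph N

  -- Cells outside the path read as Alice's, so a cell known not to be Alice's lies on the path.
  cell : Config N → ℕ → Cell
  cell c i with i <? N
  ... | yes i<N = c (fromℕ< i<N)
  ... | no _    = own A

  cell-toℕ : ∀ c (v : Fin N) → cell c (toℕ v) ≡ c v
  cell-toℕ c v with toℕ v <? N
  ... | yes v<N = cong c (fromℕ<-toℕ v v<N)
  ... | no v≮N  = ⊥-elim (v≮N (toℕ<n v))

  vertex⇒cell : ∀ {c s i} (v : Fin N) → toℕ v ≡ i → c v ≡ s → cell c i ≡ s
  vertex⇒cell {c} v refl e = trans (cell-toℕ c v) e

  cell⇒vertex : ∀ {c s i} (v : Fin N) → toℕ v ≡ i → cell c i ≡ s → c v ≡ s
  cell⇒vertex {c} v refl e = trans (sym (cell-toℕ c v)) e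

  ¬A⇒<N : ∀ {c i} → cell c i ≢ own A → i < N
  ¬A⇒<N {c} {i} ¬a with i <? N
  ... | yes i<N = i<N
  ... | no _    = ⊥-elim (¬a refl)

  free⇒¬A : ∀ {c i} → cell c i ≡ free → cell c i ≢ own A
  free⇒¬A e e′ with trans (sym e) e′
  ... | ()

  bob⇒¬A : ∀ {c i} → cell c i ≡ own B → cell c i ≢ own A
  bob⇒¬A e e′ with trans (sym e) e′
  ... | ()

  _≼_ : Config N → Config N → Set
  c ≼ c′ = ∀ {i p} → cell c i ≡ own p → cell c′ i ≡ own p

  record Claims (c : Config N) (x : ℕ) (p : Player) (c′ : Config N) : Set where
    field
      claimed   : cell c′ x ≡ own p
      elsewhere : ∀ {i} → i ≢ x → cell c′ i ≡ cell c i

    persists : cell c x ≡ free → c ≼ c′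
    persists x-free {i} e with i ≟ x
    ... | no i≢x  = trans (elsewhere i≢x) e
    ... | yes refl with trans (sym x-free) e
    ...   | ()

    keeps-free : ∀ {i} → i ≢ x → cell c i ≡ free → cell c′ i ≡ free
    keeps-free i≢x e = trans (elsewhere i≢x) e

  claim-Claims : ∀ c v p → Claims c (toℕ v) p (claim c v p)
  claim-Claims c v p = record { claimed = trans (cell-toℕ _ v) claimed-v ; elsewhere = elsewhere }
    where
    claimed-v : claim c v p v ≡ own p
    claimed-v rewrite dec-true (v ≟ᶠ v) refl = refl
    elsewhere : ∀ {i} → i ≢ toℕ v → cell (claim c v p) i ≡ cell c i
    elsewhere {i} i≢v with i <? N
    ... | no _ = refl
    ... | yes i<N
      rewrite dec-false (fromℕ< i<N ≟ᶠ v) (i≢v ∘ trans (sym (toℕ-fromℕ< i<N)) ∘ cong toℕ) = refl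

  bob-move : ∀ {c} x → cell c x ≡ free →
    (∀ {c′} → Claims c x B c′ → ¬ Dominates G (Owned c′ B) → ¬ AliceWins G c′ A) →
    ¬ AliceWins G c B
  bob-move {c} x x-free k (bobMove _ answer) = uncurry (k claims) (answer v v-free)
    where
    x<N : x < N
    x<N = ¬A⇒<N (free⇒¬A x-free)
    v : Fin N
    v = fromℕ< x<N
    claims : Claims c x B (claim c v B)
    claims = subst (λ i → Claims c i B (claim c v B)) (toℕ-fromℕ< x<N) (claim-Claims c v B)
    v-free : c v ≡ free
    v-free = cell⇒vertex v (toℕ-fromℕ< x<N) x-free

  AliceMoveFails : Config N → Set
  AliceMoveFails c = ¬ Dominates G (Owned c A) × ¬ AliceWins G c B

  every-alice-move : ∀ {c} →
    (∀ {c′} w → cell c w ≡ free → Claims c w A c′ → AliceMoveFails c′) → ¬ AliceWins G c A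
  every-alice-move {c} k (aliceMove v v-free outcome)
    with k (toℕ v) (vertex⇒cell v refl v-free) (claim-Claims c v A) | outcome
  ... | ¬dom , _ | inj₁ dom = ¬dom dom
  ... | _ , ¬win | inj₂ win = ¬win win

  record AliceGap (c : Config N) (a : ℕ) : Set where
    constructor gap
    field
      gap₀ : cell c a ≢ own A
      gap₁ : cell c (1 + a) ≢ own A
      gap₂ : cell c (2 + a) ≢ own A

  AliceGap⇒¬Dominates : ∀ {c a} → AliceGap c a → ¬ Dominates G (Owned c A)
  AliceGap⇒¬Dominates {c} {a} (gap ¬a₀ ¬a₁ ¬a₂) dom = excluded (dom v)
    where
    a+1<N : suc a < N
    a+1<N = ¬A⇒<N ¬a₁
    v : Fin N
    v = fromℕ< a+1<N
    v≡ : toℕ v ≡ suc a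
    v≡ = toℕ-fromℕ< a+1<N
    excluded : Owned c A v ⊎ ∃ (λ w → Adj G v w × Owned c A w) → ⊥
    excluded (inj₁ mine)                   = ¬a₁ (vertex⇒cell v v≡ mine)
    excluded (inj₂ (w , inj₁ next , mine)) = ¬a₂ (vertex⇒cell w (trans (sym next) (cong suc v≡)) mine)
    excluded (inj₂ (w , inj₂ prev , mine)) = ¬a₀ (vertex⇒cell w (suc-injective (trans prev v≡)) mine)

  data BobDominated (c : Config N) : ℕ → Set where
    by-self  : ∀ {i} → cell c i ≡ own B → BobDominated c i
    by-right : ∀ {i} → cell c (suc i) ≡ own B → BobDominated c i
    by-left  : ∀ {i} → cell c i ≡ own B → BobDominated c (suc i)

  BobDominated-persists : ∀ {c c′ i} → c ≼ c′ → BobDominated c i → BobDominated c′ i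
  BobDominated-persists kept (by-self e)  = by-self (kept e)
  BobDominated-persists kept (by-right e) = by-right (kept e)
  BobDominated-persists kept (by-left e)  = by-left (kept e)

  BobDominated⇒Dominates : ∀ {c} → (∀ {i} → i < N → BobDominated c i) → Dominates G (Owned c B)
  BobDominated⇒Dominates {c} all u = dominated-vertex refl (all (toℕ<n u))
    where
    neighbour : ∀ {i} → cell c i ≡ own B → Fin N
    neighbour e = fromℕ< (¬A⇒<N (bob⇒¬A e))
    neighbour≡ : ∀ {i} (e : cell c i ≡ own B) → toℕ (neighbour e) ≡ i
    neighbour≡ e = toℕ-fromℕ< (¬A⇒<N (bob⇒¬A e))
    dominated-vertex : ∀ {i} → toℕ u ≡ i → BobDominated c i →
      Owned c B u ⊎ ∃ λ w → Adj G u w × Owned c B w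
    dominated-vertex u≡ (by-self e)  = inj₁ (cell⇒vertex u u≡ e)
    dominated-vertex u≡ (by-right e) =
      inj₂ (neighbour e , inj₁ (trans (cong suc u≡) (sym (neighbour≡ e))) , cell⇒vertex _ (neighbour≡ e) e)
    dominated-vertex u≡ (by-left e)  =
      inj₂ (neighbour e , inj₂ (trans (cong suc (neighbour≡ e)) (sym u≡)) , cell⇒vertex _ (neighbour≡ e) e)

  record BobWall (c : Config N) (a : ℕ) : Set where
    constructor wall
    field
      wall₀ : cell c a ≡ own B
      wall₁ : cell c (1 + a) ≡ own B
      wall₂ : cell c (2 + a) ≡ own B

  BobWall-persists : ∀ {c c′ a} → c ≼ c′ → BobWall c a → BobWall c′ a
  BobWall-persists kept (wall b₀ b₁ b₂) = wall (kept b₀) (kept b₁) (kept b₂)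

  BobWall⇒AliceGap : ∀ {c a} → BobWall c a → AliceGap c a
  BobWall⇒AliceGap (wall b₀ b₁ b₂) = gap (bob⇒¬A b₀) (bob⇒¬A b₁) (bob⇒¬A b₂)

  claim-≼ : ∀ c v p → c v ≡ free → c ≼ claim c v p
  claim-≼ c v p v-free = Claims.persists (claim-Claims c v p) (vertex⇒cell v refl v-free)

  -- Alice can never dominate the middle cell of a wall.
  bob-wall : ∀ {c t a} → BobWall c a → ¬ AliceWins G c t
  bob-wall {c} W (aliceMove v v-free (inj₁ dom)) =
    AliceGap⇒¬Dominates (BobWall⇒AliceGap (BobWall-persists (claim-≼ c v A v-free) W)) dom
  bob-wall {c} W (aliceMove v v-free (inj₂ win)) = bob-wall (BobWall-persists (claim-≼ c v A v-free) W) win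
  bob-wall {c} W (bobMove (v , v-free) answer) with answer v v-free
  ... | _ , win = bob-wall (BobWall-persists (claim-≼ c v B v-free) W) win

  record Round (c : Config N) (x w : ℕ) (c′ : Config N) : Set where
    constructor round
    field
      {middle}     : Config N
      x-free       : cell c x ≡ free
      bob-claims   : Claims c x B middle
      w-free       : cell middle w ≡ free
      alice-claims : Claims middle w A c′

    persists : c ≼ c′
    persists e = Claims.persists alice-claims w-free (Claims.persists bob-claims x-free e)

    bob-owns : cell c′ x ≡ own B
    bob-owns = Claims.persists alice-claims w-free (Claims.claimed bob-claims)

    keeps-free : ∀ {i} → i ≢ x → i ≢ w → cell c i ≡ free → cell c′ i ≡ free
    keeps-free i≢x i≢w = Claims.keeps-free alice-claims i≢w ∘ Claims.keeps-free bob-claims i≢x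

    keeps-gap : ∀ {a} → 2 + a < w → AliceGap c a → AliceGap c′ a
    keeps-gap {a} a+2<w (gap ¬a₀ ¬a₁ ¬a₂) =
      gap (keep (<⇒≢ (≤-trans (s≤s (m≤n+m a 2)) a+2<w)) ¬a₀)
          (keep (<⇒≢ (≤-trans (s≤s (m≤n+m (1 + a) 1)) a+2<w)) ¬a₁)
          (keep (<⇒≢ a+2<w) ¬a₂)
      where
      keep : ∀ {i} → i ≢ w → cell c i ≢ own A → cell c′ i ≢ own A
      keep {i} i≢w ¬a e with i ≟ x
      ... | yes refl = bob⇒¬A (Claims.claimed bob-claims) (trans (sym (Claims.elsewhere alice-claims i≢w)) e)
      ... | no i≢x   = ¬a (trans (sym (Claims.elsewhere bob-claims i≢x))
                                (trans (sym (Claims.elsewhere alice-claims i≢w)) e))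

  bob-opens : ∀ {c} x → cell c x ≡ free →
    (∀ {c′} w → Round c x w c′ → AliceMoveFails c′) → ¬ AliceWins G c B
  bob-opens x x-free answer =
    bob-move x x-free λ bx _ → every-alice-move λ w w-free aw → answer w (round x-free bx w-free aw)

  data Walled (c : Config N) (x t : ℕ) : ℕ → Set where
    bob    : ∀ {i} → cell c i ≡ own B → Walled c x t i
    move   : Walled c x t x
    target : Walled c x t t

  walled-¬A : ∀ {c c′ x t i} → Walled c x t i → c ≼ c′ → cell c′ x ≡ own B → cell c′ t ≡ free →
    cell c′ i ≢ own A
  walled-¬A (bob e) kept _     _      = bob⇒¬A (kept e)
  walled-¬A move    _ x-bob _      = bob⇒¬A x-bob
  walled-¬A target  _ _     t-free = free⇒¬A t-free

  walled-bob : ∀ {c c′ x t i} → Walled c x t i → c ≼ c′ → cell c′ x ≡ own B → cell c′ t ≡ own B →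
    cell c′ i ≡ own B
  walled-bob (bob e) kept _     _     = kept e
  walled-bob move    _ x-bob _     = x-bob
  walled-bob target  _ _     t-bob = t-bob

  -- After Bob claims x, claiming t as well would give him the three cells a, 1 + a, 2 + a.
  record Threatening (c : Config N) (x t a : ℕ) : Set where
    constructor threatening
    field
      target≢move : t ≢ x
      target-free : cell c t ≡ free
      walled₀     : Walled c x t a
      walled₁     : Walled c x t (1 + a)
      walled₂     : Walled c x t (2 + a)

  threat-stands : ∀ {c c′ x w t a} → Threatening c x t a → Round c x w c′ → t ≢ w → AliceMoveFails c′
  threat-stands {c} {c′} {x} {t = t} (threatening t≢x t-free w₀ w₁ w₂) r t≢w =
    AliceGap⇒¬Dominates (gap (open-gap w₀) (open-gap w₁) (open-gap w₂)) ,
    bob-move t t-free′ λ bt _ → bob-wall (wall (closed bt w₀) (closed bt w₁) (closed bt w₂))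
    where
    t-free′ : cell c′ t ≡ free
    t-free′ = Round.keeps-free r t≢x t≢w t-free
    open-gap : ∀ {i} → Walled c x t i → cell c′ i ≢ own A
    open-gap wi = walled-¬A wi (Round.persists r) (Round.bob-owns r) t-free′
    closed : ∀ {c″ i} → Claims c′ t B c″ → Walled c x t i → cell c″ i ≡ own B
    closed bt wi = walled-bob wi (Claims.persists bt t-free′ ∘ Round.persists r)
                     (Claims.persists bt t-free′ (Round.bob-owns r)) (Claims.claimed bt)

  bob-threatens : ∀ {c t a} x → cell c x ≡ free → Threatening c x t a →
    (∀ {c′} → Round c x t c′ → AliceMoveFails c′) → ¬ AliceWins G c B
  bob-threatens {t = t} x x-free T parried = bob-opens x x-free answer
    where
    answer : ∀ {c′} w → Round _ x w c′ → AliceMoveFails c′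
    answer w r with w ≟ t
    ... | yes refl = parried r
    ... | no w≢t   = threat-stands T r (≢-sym w≢t)

  bob-double-threat : ∀ {c t₁ t₂ a₁ a₂} x → cell c x ≡ free → t₁ ≢ t₂ →
    Threatening c x t₁ a₁ → Threatening c x t₂ a₂ → ¬ AliceWins G c B
  bob-double-threat x x-free t₁≢t₂ T₁ T₂ =
    bob-threatens x x-free T₁ λ r → threat-stands T₂ r (≢-sym t₁≢t₂)

  free-bob-free-free : ∀ {c a} → cell c a ≡ free → cell c (1 + a) ≡ own B → cell c (2 + a) ≡ free →
    cell c (3 + a) ≡ free → AliceMoveFails c
  free-bob-free-free {a = a} f₀ b₁ f₂ f₃ =
    AliceGap⇒¬Dominates (gap (free⇒¬A f₀) (bob⇒¬A b₁) (free⇒¬A f₂)) ,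
    bob-double-threat (2 + a) f₂ (λ ())
      (threatening (λ ()) f₀ target (bob b₁) move)
      (threatening (λ ()) f₃ (bob b₁) move target)

  free-free-bob-free : ∀ {c a} → cell c a ≡ free → cell c (1 + a) ≡ free → cell c (2 + a) ≡ own B →
    cell c (3 + a) ≡ free → AliceMoveFails c
  free-free-bob-free {a = a} f₀ f₁ b₂ f₃ =
    AliceGap⇒¬Dominates (gap (free⇒¬A f₀) (free⇒¬A f₁) (bob⇒¬A b₂)) ,
    bob-double-threat (1 + a) f₁ (λ ())
      (threatening (λ ()) f₀ target move (bob b₂))
      (threatening (λ ()) f₃ move (bob b₂) target)

  record ExtendsUpTo (c : Config N) (h : ℕ) (c′ : Config N) : Set where
    field
      persists    : c ≼ c′
      free-beyond : ∀ {i} → h < i → cell c i ≡ free → cell c′ i ≡ free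

  ExtendsUpTo-refl : ∀ {c h} → ExtendsUpTo c h c
  ExtendsUpTo-refl = record { persists = λ e → e ; free-beyond = λ _ e → e }

  ExtendsUpTo-trans : ∀ {c c′ c″ h} → ExtendsUpTo c h c′ → ExtendsUpTo c′ h c″ → ExtendsUpTo c h c″
  ExtendsUpTo-trans e₁ e₂ = record
    { persists    = ExtendsUpTo.persists e₂ ∘ ExtendsUpTo.persists e₁
    ; free-beyond = λ h<i → ExtendsUpTo.free-beyond e₂ h<i ∘ ExtendsUpTo.free-beyond e₁ h<i }

  Claims⇒ExtendsUpTo : ∀ {c c′ x p h} → Claims c x p c′ → cell c x ≡ free → x ≤ h → ExtendsUpTo c h c′
  Claims⇒ExtendsUpTo cl x-free x≤h = record
    { persists    = Claims.persists cl x-free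
    ; free-beyond = λ h<i → Claims.keeps-free cl (>⇒≢ (≤-<-trans x≤h h<i)) }

  Round⇒ExtendsUpTo : ∀ {c c′ x w h} → Round c x w c′ → x ≤ h → w ≤ h → ExtendsUpTo c h c′
  Round⇒ExtendsUpTo r x≤h w≤h = record
    { persists    = Round.persists r
    ; free-beyond = λ h<i → Round.keeps-free r (>⇒≢ (≤-<-trans x≤h h<i)) (>⇒≢ (≤-<-trans w≤h h<i)) }

  module Race (E : ℕ) (N≡ : N ≡ suc (suc E)) where

    record Suffix (c : Config N) (g L : ℕ) : Set where
      field
        length     : suc (L + g) ≡ E
        last-bob   : cell c (suc E) ≡ own B
        free-ahead : ∀ {i} → g < i → i < E → cell c i ≡ free

      ahead : ∀ j → {True (1 ≤? j)} → {True (j ≤? L)} → cell c (j + g) ≡ free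
      ahead j {1≤j} {j≤L} =
        free-ahead (+-monoˡ-≤ g (toWitness 1≤j)) (subst (j + g <_) length (s≤s (+-monoˡ-≤ g (toWitness j≤L))))

    Suffix-advance : ∀ d {c c′ g L} → Suffix c g (d + L) → ExtendsUpTo c (d + g) c′ → Suffix c′ (d + g) L
    Suffix-advance d {g = g} {L} S ext = record
      { length     = trans (cong suc shift) (Suffix.length S)
      ; last-bob   = ExtendsUpTo.persists ext (Suffix.last-bob S)
      ; free-ahead = λ d+g<i i<E →
          ExtendsUpTo.free-beyond ext d+g<i (Suffix.free-ahead S (≤-<-trans (m≤n+m g d) d+g<i) i<E) }
      where
      shift : L + (d + g) ≡ (d + L) + g
      shift = trans (sym (+-assoc L d g)) (cong (_+ g) (+-comm L d))

    UpTo : ℕ → (ℕ → Set) → Set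
    UpTo g D = ∀ {i} → i ≤ g → D i

    UpTo-extend : ∀ d {g} {D : ℕ → Set} → UpTo g D → ((j : Fin d) → D (suc (toℕ j) + g)) → UpTo (d + g) D
    UpTo-extend d {g} {D} old new {i} i≤d+g with i ≤? g
    ... | yes i≤g = old i≤g
    ... | no i≰g with <⇒∃-suc-+ (≰⇒> i≰g)
    ...   | j , refl = subst D (cong (λ k → suc (k + g)) (toℕ-fromℕ< j<d)) (new (fromℕ< j<d))
      where
      j<d : j < d
      j<d = +-cancelʳ-< g j d i≤d+g

    record Frontier (c : Config N) (g L : ℕ) : Set where
      field
        suffix    : Suffix c g L
        dominated : UpTo g (BobDominated c)

    advance : ∀ d {c c′ g L} → Frontier c g (d + L) → ExtendsUpTo c (d + g) c′ →
      ((j : Fin d) → BobDominated c′ (suc (toℕ j) + g)) → Frontier c′ (d + g) L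
    advance d F ext new = record
      { suffix    = Suffix-advance d (Frontier.suffix F) ext
      ; dominated = UpTo-extend d (BobDominated-persists (ExtendsUpTo.persists ext) ∘ Frontier.dominated F) new }

    Frontier⇒AliceMoveFails : ∀ {c g L} → Frontier c g (3 + L) → ¬ AliceWins G c B → AliceMoveFails c
    Frontier⇒AliceMoveFails F ¬win =
      AliceGap⇒¬Dominates (gap (free⇒¬A (ahead 1)) (free⇒¬A (ahead 2)) (free⇒¬A (ahead 3))) , ¬win
      where open Suffix (Frontier.suffix F)

    Frontier⇒Dominates : ∀ {c g} → Frontier c g 0 → Dominates G (Owned c B)
    Frontier⇒Dominates {c} {g} F = BobDominated⇒Dominates covered
      where
      open Suffix (Frontier.suffix F)
      covered : ∀ {i} → i < N → BobDominated c i
      covered {i} i<N with i ≤? g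
      ... | yes i≤g = Frontier.dominated F i≤g
      ... | no i≰g with i ≟ E
      ...   | yes refl = by-right last-bob
      ...   | no i≢E   = by-self (subst (λ k → cell c k ≡ own B) (sym i≡1+E) last-bob)
        where
        i≡1+E : i ≡ suc E
        i≡1+E = ≤-antisym (≤-pred (subst (i <_) N≡ i<N))
                          (≤∧≢⇒< (subst (_≤ i) length (≰⇒> i≰g)) (≢-sym i≢E))

    Frontier-complete : ∀ d {c c′ g} → Frontier c g d → ExtendsUpTo c (d + g) c′ →
      ((j : Fin d) → BobDominated c′ (suc (toℕ j) + g)) → Dominates G (Owned c′ B)
    Frontier-complete d {c} {g = g} F ext new =
      Frontier⇒Dominates (advance d (subst (Frontier c g) (sym (+-identityʳ d)) F) ext new)

    bob-completes : ∀ d {c c′ g} x → Frontier c g d → ExtendsUpTo c (d + g) c′ →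
      cell c′ x ≡ free → x ≤ d + g →
      (∀ {c″} → Claims c′ x B c″ → (j : Fin d) → BobDominated c″ (suc (toℕ j) + g)) →
      ¬ AliceWins G c′ B
    bob-completes d x F ext x-free x≤ new = bob-move x x-free λ cl ¬dom _ →
      ¬dom (Frontier-complete d F (ExtendsUpTo-trans ext (Claims⇒ExtendsUpTo cl x-free x≤)) (new cl))

    data Near : ℕ → ℕ → Set where
      same  : ∀ {z} → Near z z
      right : ∀ {z} → Near z (suc z)
      left  : ∀ {i} → Near (suc i) i

    Near-covered : ∀ {c c′ z i} → Claims c z B c′ → Near z i → BobDominated c′ i
    Near-covered cl same  = by-self (Claims.claimed cl)
    Near-covered cl right = by-left (Claims.claimed cl)
    Near-covered cl left  = by-right (Claims.claimed cl)

    DominatedOrNear : Config N → ℕ → ℕ → Set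
    DominatedOrNear c z i = BobDominated c i ⊎ Near z i

    -- A frontier except for the neighbourhood of a free cell z that Bob keeps in reserve.
    record SpareFrontier (c : Config N) (g L z : ℕ) : Set where
      field
        suffix            : Suffix c g L
        dominated-or-near : UpTo g (DominatedOrNear c z)
        spare-free        : cell c z ≡ free
        spare-behind      : z < g

    spare-completes : ∀ d {c g z} → SpareFrontier c g d z →
      (∀ {c′} → Claims c z B c′ → (j : Fin d) → BobDominated c′ (suc (toℕ j) + g)) → ¬ AliceWins G c B
    spare-completes d {g = g} S new = bob-move _ spare-free λ cl ¬dom _ →
      ¬dom (Frontier-complete d (F cl) ExtendsUpTo-refl (new cl))
      where
      open SpareFrontier S
      F : ∀ {c′} → Claims _ _ B c′ → Frontier c′ g d
      F cl = record
        { suffix    = Suffix-advance 0 suffix (Claims⇒ExtendsUpTo cl spare-free (<⇒≤ spare-behind))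
        ; dominated = [ BobDominated-persists (Claims.persists cl spare-free) , Near-covered cl ]′
                        ∘ dominated-or-near }

    holds-short : ∀ L {c g} {1≤L : True (1 ≤? L)} {L≤3 : True (L ≤? 3)} → Frontier c g L → ¬ AliceWins G c B
    holds-short zero {1≤L = ()}
    holds-short (suc zero) {g = g} F =
      bob-completes 1 (1 + g) F ExtendsUpTo-refl (Suffix.ahead (Frontier.suffix F) 1) ≤-refl
        λ cl → λ { zero → by-self (Claims.claimed cl) }
    holds-short (suc (suc zero)) {g = g} F =
      bob-completes 2 (2 + g) F ExtendsUpTo-refl (Suffix.ahead (Frontier.suffix F) 2) ≤-refl
        λ cl → λ { zero → by-right (Claims.claimed cl) ; (suc zero) → by-self (Claims.claimed cl) }
    holds-short (suc (suc (suc zero))) {g = g} F =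
      bob-completes 3 (2 + g) F ExtendsUpTo-refl (Suffix.ahead (Frontier.suffix F) 2) (≤-offset 2 3)
        λ cl → λ { zero             → by-right (Claims.claimed cl)
                 ; (suc zero)       → by-self (Claims.claimed cl)
                 ; (suc (suc zero)) → by-left (Claims.claimed cl) }
    holds-short (suc (suc (suc (suc _)))) {L≤3 = ()}

    holds-with-spare : ∀ L {c g z u} → SpareFrontier c g L z → cell c g ≡ own B → AliceGap c u → 2 + u < g →
      ¬ AliceWins G c B
    holds-with-spare zero S _ _ _ = spare-completes 0 S λ _ ()
    holds-with-spare (suc zero) S g-bob _ _ =
      spare-completes 1 S λ cl → λ { zero → by-left (Claims.persists cl (SpareFrontier.spare-free S) g-bob) }
    holds-with-spare (suc (suc L)) {c} {g} {z} {u} S g-bob gap-u u+2<g =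
      bob-opens (2 + g) (Suffix.ahead suffix 2) answer
      where
      open SpareFrontier S
      z≢ : ∀ j → z ≢ j + g
      z≢ j = <⇒≢ (≤-trans spare-behind (m≤n+m g j))
      answer : ∀ {c′} w → Round c (2 + g) w c′ → AliceMoveFails c′
      answer w r with w ≟ 1 + g
      ... | yes refl =
        AliceGap⇒¬Dominates gap′ , holds-with-spare L S′ (Round.bob-owns r) gap′ (≤-trans u+2<g (m≤n+m g 2))
        where
        gap′ = Round.keeps-gap r (≤-trans u+2<g (m≤n+m g 1)) gap-u
        S′ : SpareFrontier _ (2 + g) L z
        S′ = record
          { suffix            = Suffix-advance 2 suffix (Round⇒ExtendsUpTo r ≤-refl (≤-offset 1 2))
          ; dominated-or-near = UpTo-extend 2 (map₁ (BobDominated-persists (Round.persists r)) ∘ dominated-or-near)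
              λ { zero → inj₁ (by-right (Round.bob-owns r)) ; (suc zero) → inj₁ (by-self (Round.bob-owns r)) }
          ; spare-free        = Round.keeps-free r (z≢ 2) (z≢ 1) spare-free
          ; spare-behind      = ≤-trans spare-behind (m≤n+m g 2) }
      ... | no w≢1 =
        AliceGap⇒¬Dominates (gap (bob⇒¬A g-bob′) (free⇒¬A one) (bob⇒¬A two)) ,
        bob-move (1 + g) one λ cl _ →
          bob-wall (wall (Claims.persists cl one g-bob′) (Claims.claimed cl) (Claims.persists cl one two))
        where
        one = Round.keeps-free r (λ ()) (≢-sym w≢1) (Suffix.ahead suffix 1)
        two = Round.bob-owns r
        g-bob′ = Round.persists r g-bob

    HoldsWithGap : ℕ → Set
    HoldsWithGap L =
      ∀ {c g u} → Frontier c g L → AliceGap c u → 2 + u < g → cell c u ≡ free → ¬ AliceWins G c B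

    holds-with-gap-step : ∀ {L} → HoldsWithGap (1 + L) → HoldsWithGap L → HoldsWithGap (4 + L)
    holds-with-gap-step {L} ih₁ ih₀ {c} {g} {u} F gap-u u+2<g u-free = bob-opens (2 + g) (ahead 2) answer
      where
      open Frontier F
      open Suffix suffix
      u<g : u < g
      u<g = ≤-trans (s≤s (m≤n+m u 2)) u+2<g
      u≢ : ∀ j → u ≢ j + g
      u≢ j = <⇒≢ (≤-trans u<g (m≤n+m g j))
      behind : ∀ j → 2 + u < j + g
      behind j = ≤-trans u+2<g (m≤n+m g j)
      spare : ∀ {c′} → Round c (2 + g) (1 + g) c′ → SpareFrontier c′ (2 + g) (2 + L) u
      spare r = record
        { suffix            = Suffix-advance 2 suffix (Round⇒ExtendsUpTo r ≤-refl (≤-offset 1 2))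
        ; dominated-or-near = UpTo-extend 2 {D = DominatedOrNear _ u}
            (λ i≤g → inj₁ (BobDominated-persists (Round.persists r) (dominated i≤g)))
            λ { zero → inj₁ (by-right (Round.bob-owns r)) ; (suc zero) → inj₁ (by-self (Round.bob-owns r)) }
        ; spare-free        = Round.keeps-free r (u≢ 2) (u≢ 1) u-free
        ; spare-behind      = ≤-trans u<g (m≤n+m g 2) }
      forced : ∀ {c′} → Round c (2 + g) (4 + g) c′ → ¬ AliceWins G c′ B
      forced r = bob-threatens (3 + g) (Round.keeps-free r (λ ()) (λ ()) (ahead 3))
        (threatening (λ ()) (Round.keeps-free r (λ ()) (λ ()) (ahead 1)) target (bob (Round.bob-owns r)) move)
        λ r′ → let gap″ = Round.keeps-gap r′ (behind 1) (Round.keeps-gap r (behind 4) gap-u) in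
          AliceGap⇒¬Dominates gap″ ,
          ih₀ (advance 4 F (ExtendsUpTo-trans (Round⇒ExtendsUpTo r (≤-offset 2 4) ≤-refl)
                                              (Round⇒ExtendsUpTo r′ (≤-offset 3 4) (≤-offset 1 4)))
                λ { zero                   → by-right (Round.persists r′ (Round.bob-owns r))
                  ; (suc zero)             → by-self (Round.persists r′ (Round.bob-owns r))
                  ; (suc (suc zero))       → by-self (Round.bob-owns r′)
                  ; (suc (suc (suc zero))) → by-left (Round.bob-owns r′) })
              gap″ (behind 4) (Round.keeps-free r′ (u≢ 3) (u≢ 1) (Round.keeps-free r (u≢ 2) (u≢ 4) u-free))
      answer : ∀ {c′} w → Round c (2 + g) w c′ → AliceMoveFails c′
      answer w r with w ≟ 1 + g | w ≟ 3 + g | w ≟ 4 + g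
      ... | yes refl | _ | _ =
        AliceGap⇒¬Dominates gap′ , holds-with-spare (2 + L) (spare r) (Round.bob-owns r) gap′ (behind 2)
        where gap′ = Round.keeps-gap r (behind 1) gap-u
      ... | no _ | yes refl | _ =
        AliceGap⇒¬Dominates gap′ ,
        ih₁ (advance 3 F (Round⇒ExtendsUpTo r (≤-offset 2 3) ≤-refl)
              λ { zero             → by-right (Round.bob-owns r)
                ; (suc zero)       → by-self (Round.bob-owns r)
                ; (suc (suc zero)) → by-left (Round.bob-owns r) })
            gap′ (behind 3) (Round.keeps-free r (u≢ 2) (u≢ 3) u-free)
        where gap′ = Round.keeps-gap r (behind 3) gap-u
      ... | no _ | no _ | yes refl = AliceGap⇒¬Dominates (Round.keeps-gap r (behind 4) gap-u) , forced r
      ... | no w≢1 | no w≢3 | no w≢4 =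
        free-bob-free-free (Round.keeps-free r (λ ()) (≢-sym w≢1) (ahead 1)) (Round.bob-owns r)
                           (Round.keeps-free r (λ ()) (≢-sym w≢3) (ahead 3))
                           (Round.keeps-free r (λ ()) (≢-sym w≢4) (ahead 4))

    holds-with-gap : ∀ L → HoldsWithGap L
    -- Bob already dominates; the free cell u gives him the move that makes it count.
    holds-with-gap zero F _ u+2<g u-free =
      bob-completes 0 _ F ExtendsUpTo-refl u-free (≤-trans (m≤n+m _ 2) (<⇒≤ u+2<g)) λ _ ()
    holds-with-gap (suc zero) F _ _ _ = holds-short 1 F
    holds-with-gap (suc (suc zero)) F _ _ _ = holds-short 2 F
    holds-with-gap (suc (suc (suc zero))) F _ _ _ = holds-short 3 F
    holds-with-gap (suc (suc (suc (suc L)))) = holds-with-gap-step (holds-with-gap (suc L)) (holds-with-gap L)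

    -- The pocket 1 + g, 2 + g, 3 + g holds no Alice cell and becomes the gap of holds-with-gap.
    holds-split : ∀ m {c c′ g} → Frontier c g (6 + m * 3) → Round c (2 + g) (4 + g) c′ → ¬ AliceWins G c′ B
    holds-split zero {g = g} F r =
      bob-completes 6 (5 + g) F (Round⇒ExtendsUpTo r (≤-offset 2 6) (≤-offset 4 6)) five (≤-offset 5 6)
        λ cl → let two = Claims.persists cl five (Round.bob-owns r) in
          λ { zero                               → by-right two
            ; (suc zero)                         → by-self two
            ; (suc (suc zero))                   → by-left two
            ; (suc (suc (suc zero)))             → by-right (Claims.claimed cl)
            ; (suc (suc (suc (suc zero))))       → by-self (Claims.claimed cl)
            ; (suc (suc (suc (suc (suc zero))))) → by-left (Claims.claimed cl) }
      where five = Round.keeps-free r (λ ()) (λ ()) (Suffix.ahead (Frontier.suffix F) 5)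
    holds-split (suc m) {c} {c′} {g} F r = bob-opens (7 + g) (free′ 7 (λ ()) (λ ())) answer
      where
      open Frontier F
      open Suffix suffix
      free′ : ∀ j {1≤j : True (1 ≤? j)} {j≤L : True (j ≤? 9 + m * 3)} →
        j + g ≢ 2 + g → j + g ≢ 4 + g → cell c′ (j + g) ≡ free
      free′ j {1≤j} {j≤L} j≢2 j≢4 = Round.keeps-free r j≢2 j≢4 (ahead j {1≤j} {j≤L})
      two : cell c′ (2 + g) ≡ own B
      two = Round.bob-owns r
      pocket : ∀ {c″ w} → Round c′ (7 + g) w c″ → 1 + g ≢ w → 3 + g ≢ w → AliceGap c″ (1 + g)
      pocket r′ one≢w three≢w =
        gap (free⇒¬A (Round.keeps-free r′ (λ ()) one≢w (free′ 1 (λ ()) (λ ()))))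
            (bob⇒¬A (Round.persists r′ two))
            (free⇒¬A (Round.keeps-free r′ (λ ()) three≢w (free′ 3 (λ ()) (λ ()))))
      after-8 : ∀ {c″} → Round c′ (7 + g) (8 + g) c″ → ¬ AliceWins G c″ B
      after-8 r′ = bob-threatens (5 + g) (Round.keeps-free r′ (λ ()) (λ ()) (free′ 5 (λ ()) (λ ())))
        (threatening (λ ()) (Round.keeps-free r′ (λ ()) (λ ()) (free′ 6 (λ ()) (λ ()))) move target (bob seven))
        λ r″ → let gap″ = Round.keeps-gap r″ (≤-offset 4 6) (pocket r′ (λ ()) (λ ()))
                   two″ = Round.persists r″ (Round.persists r′ two)
                   five″ = Round.bob-owns r″
                   seven″ = Round.persists r″ seven in
          AliceGap⇒¬Dominates gap″ ,
          holds-with-gap (1 + m * 3)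
            (advance 8 F (ExtendsUpTo-trans (Round⇒ExtendsUpTo r (≤-offset 2 8) (≤-offset 4 8))
                           (ExtendsUpTo-trans (Round⇒ExtendsUpTo r′ (≤-offset 7 8) ≤-refl)
                                              (Round⇒ExtendsUpTo r″ (≤-offset 5 8) (≤-offset 6 8))))
              λ { zero                                           → by-right two″
                ; (suc zero)                                     → by-self two″
                ; (suc (suc zero))                               → by-left two″
                ; (suc (suc (suc zero)))                         → by-right five″
                ; (suc (suc (suc (suc zero))))                   → by-self five″
                ; (suc (suc (suc (suc (suc zero)))))             → by-left five″
                ; (suc (suc (suc (suc (suc (suc zero))))))       → by-self seven″
                ; (suc (suc (suc (suc (suc (suc (suc zero))))))) → by-left seven″ })
            gap″ (≤-offset 4 8)
            (Round.keeps-free r″ (λ ()) (λ ()) (Round.keeps-free r′ (λ ()) (λ ()) (free′ 1 (λ ()) (λ ()))))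
        where seven = Round.bob-owns r′
      spare : ∀ {c″ c‴} → Round c′ (7 + g) (6 + g) c″ → Round c″ (9 + g) (8 + g) c‴ →
        SpareFrontier c‴ (9 + g) (m * 3) (5 + g)
      spare r′ r″ = record
        { suffix            = Suffix-advance 9 suffix
                                (ExtendsUpTo-trans (Round⇒ExtendsUpTo r (≤-offset 2 9) (≤-offset 4 9))
                                  (ExtendsUpTo-trans (Round⇒ExtendsUpTo r′ (≤-offset 7 9) (≤-offset 6 9))
                                                     (Round⇒ExtendsUpTo r″ ≤-refl (≤-offset 8 9))))
        ; dominated-or-near = UpTo-extend 9 {D = DominatedOrNear _ (5 + g)}
            (λ i≤g → inj₁ (BobDominated-persists (Round.persists r″ ∘ Round.persists r′ ∘ Round.persists r)
                                                  (dominated i≤g)))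
            λ { zero                                                 → inj₁ (by-right two″)
              ; (suc zero)                                           → inj₁ (by-self two″)
              ; (suc (suc zero))                                     → inj₁ (by-left two″)
              ; (suc (suc (suc zero)))                               → inj₂ left
              ; (suc (suc (suc (suc zero))))                         → inj₂ same
              ; (suc (suc (suc (suc (suc zero)))))                   → inj₂ right
              ; (suc (suc (suc (suc (suc (suc zero))))))             → inj₁ (by-self seven″)
              ; (suc (suc (suc (suc (suc (suc (suc zero)))))))       → inj₁ (by-left seven″)
              ; (suc (suc (suc (suc (suc (suc (suc (suc zero)))))))) → inj₁ (by-self (Round.bob-owns r″)) }
        ; spare-free        = Round.keeps-free r″ (λ ()) (λ ())
                                (Round.keeps-free r′ (λ ()) (λ ()) (free′ 5 (λ ()) (λ ())))
        ; spare-behind      = ≤-offset 6 9 }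
        where
        two″ = Round.persists r″ (Round.persists r′ two)
        seven″ = Round.persists r″ (Round.bob-owns r′)
      after-6 : ∀ {c″} → Round c′ (7 + g) (6 + g) c″ → ¬ AliceWins G c″ B
      after-6 r′ = bob-threatens (9 + g) (Round.keeps-free r′ (λ ()) (λ ()) (free′ 9 (λ ()) (λ ())))
        (threatening (λ ()) (Round.keeps-free r′ (λ ()) (λ ()) (free′ 8 (λ ()) (λ ())))
          (bob (Round.bob-owns r′)) target move)
        λ r″ → let gap″ = Round.keeps-gap r″ (≤-offset 4 8) (pocket r′ (λ ()) (λ ())) in
          AliceGap⇒¬Dominates gap″ ,
          holds-with-spare (m * 3) (spare r′ r″) (Round.bob-owns r″) gap″ (≤-offset 4 9)
      answer : ∀ {c″} w → Round c′ (7 + g) w c″ → AliceMoveFails c″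
      answer w r′ with w ≟ 8 + g | w ≟ 6 + g | w ≟ 9 + g
      ... | yes refl | _ | _ = AliceGap⇒¬Dominates (pocket r′ (λ ()) (λ ())) , after-8 r′
      ... | no _ | yes refl | _ = AliceGap⇒¬Dominates (pocket r′ (λ ()) (λ ())) , after-6 r′
      ... | no _ | no _ | yes refl =
        free-free-bob-free (Round.keeps-free r′ (λ ()) (λ ()) (free′ 5 (λ ()) (λ ())))
                           (Round.keeps-free r′ (λ ()) (λ ()) (free′ 6 (λ ()) (λ ())))
                           (Round.bob-owns r′)
                           (Round.keeps-free r′ (λ ()) (λ ()) (free′ 8 (λ ()) (λ ())))
      ... | no w≢8 | no w≢6 | no w≢9 =
        free-bob-free-free (Round.keeps-free r′ (λ ()) (≢-sym w≢6) (free′ 6 (λ ()) (λ ())))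
                           (Round.bob-owns r′)
                           (Round.keeps-free r′ (λ ()) (≢-sym w≢8) (free′ 8 (λ ()) (λ ())))
                           (Round.keeps-free r′ (λ ()) (≢-sym w≢9) (free′ 9 (λ ()) (λ ())))

    HoldsOpen : ℕ → Set
    HoldsOpen m = ∀ {c g} → Frontier c g (3 + m * 3) → ¬ AliceWins G c B

    HoldsOwned : ℕ → Set
    HoldsOwned m = ∀ {c g} → Frontier c g (4 + m * 3) → cell c g ≡ own B → ¬ AliceWins G c B

    holds-open-step : ∀ {m} → HoldsOpen m → HoldsOwned m → HoldsOpen (suc m)
    holds-open-step {m} ih-open ih-owned {c} {g} F = bob-opens (2 + g) (ahead 2) answer
      where
      open Frontier F
      open Suffix suffix
      answer : ∀ {c′} w → Round c (2 + g) w c′ → AliceMoveFails c′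
      answer w r with w ≟ 3 + g | w ≟ 1 + g | w ≟ 4 + g
      ... | yes refl | _ | _ = Frontier⇒AliceMoveFails F′ (ih-open F′)
        where
        F′ = advance 3 F (Round⇒ExtendsUpTo r (≤-offset 2 3) ≤-refl)
               λ { zero             → by-right (Round.bob-owns r)
                 ; (suc zero)       → by-self (Round.bob-owns r)
                 ; (suc (suc zero)) → by-left (Round.bob-owns r) }
      ... | no _ | yes refl | _ = Frontier⇒AliceMoveFails F′ (ih-owned F′ (Round.bob-owns r))
        where
        F′ = advance 2 F (Round⇒ExtendsUpTo r ≤-refl (≤-offset 1 2))
               λ { zero → by-right (Round.bob-owns r) ; (suc zero) → by-self (Round.bob-owns r) }
      ... | no _ | no _ | yes refl =
        AliceGap⇒¬Dominates (gap (free⇒¬A (Round.keeps-free r (λ ()) (λ ()) (ahead 1)))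
                                 (bob⇒¬A (Round.bob-owns r))
                                 (free⇒¬A (Round.keeps-free r (λ ()) (λ ()) (ahead 3)))) ,
        holds-split m F r
      ... | no w≢3 | no w≢1 | no w≢4 =
        free-bob-free-free (Round.keeps-free r (λ ()) (≢-sym w≢1) (ahead 1)) (Round.bob-owns r)
                           (Round.keeps-free r (λ ()) (≢-sym w≢3) (ahead 3))
                           (Round.keeps-free r (λ ()) (≢-sym w≢4) (ahead 4))

    holds-owned-step : ∀ {m} → HoldsOpen m → HoldsOwned m → HoldsOwned (suc m)
    holds-owned-step {m} ih-open ih-owned {c} {g} F g-bob = bob-opens (3 + g) (ahead 3) answer
      where
      open Frontier F
      open Suffix suffix
      forced : ∀ {c′} → Round c (3 + g) (4 + g) c′ → ¬ AliceWins G c′ B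
      forced {c′} r = bob-threatens (2 + g) (Round.keeps-free r (λ ()) (λ ()) (ahead 2))
        (threatening (λ ()) (Round.keeps-free r (λ ()) (λ ()) (ahead 1)) (bob (Round.persists r g-bob)) target move)
        λ r′ → Frontier⇒AliceMoveFails (F′ r′) (ih-open (F′ r′))
        where
        F′ : ∀ {c″} → Round c′ (2 + g) (1 + g) c″ → Frontier c″ (4 + g) (3 + m * 3)
        F′ r′ = advance 4 F (ExtendsUpTo-trans (Round⇒ExtendsUpTo r (≤-offset 3 4) ≤-refl)
                                               (Round⇒ExtendsUpTo r′ (≤-offset 2 4) (≤-offset 1 4)))
                  λ { zero                   → by-right (Round.bob-owns r′)
                    ; (suc zero)             → by-self (Round.bob-owns r′)
                    ; (suc (suc zero))       → by-self (Round.persists r′ (Round.bob-owns r))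
                    ; (suc (suc (suc zero))) → by-left (Round.persists r′ (Round.bob-owns r)) }
      answer : ∀ {c′} w → Round c (3 + g) w c′ → AliceMoveFails c′
      answer w r with w ≟ 2 + g | w ≟ 4 + g | w ≟ 5 + g
      ... | yes refl | _ | _ = Frontier⇒AliceMoveFails F′ (ih-owned F′ (Round.bob-owns r))
        where
        F′ = advance 3 F (Round⇒ExtendsUpTo r ≤-refl (≤-offset 2 3))
               λ { zero             → by-left (Round.persists r g-bob)
                 ; (suc zero)       → by-right (Round.bob-owns r)
                 ; (suc (suc zero)) → by-self (Round.bob-owns r) }
      ... | no _ | yes refl | _ =
        AliceGap⇒¬Dominates (gap (free⇒¬A (Round.keeps-free r (λ ()) (λ ()) (ahead 1)))
                                 (free⇒¬A (Round.keeps-free r (λ ()) (λ ()) (ahead 2)))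
                                 (bob⇒¬A (Round.bob-owns r))) ,
        forced r
      ... | no _ | no _ | yes refl =
        free-free-bob-free (Round.keeps-free r (λ ()) (λ ()) (ahead 1)) (Round.keeps-free r (λ ()) (λ ()) (ahead 2))
                           (Round.bob-owns r) (Round.keeps-free r (λ ()) (λ ()) (ahead 4))
      ... | no w≢2 | no w≢4 | no w≢5 =
        free-bob-free-free (Round.keeps-free r (λ ()) (≢-sym w≢2) (ahead 2)) (Round.bob-owns r)
                           (Round.keeps-free r (λ ()) (≢-sym w≢4) (ahead 4))
                           (Round.keeps-free r (λ ()) (≢-sym w≢5) (ahead 5))

    holds-open : ∀ m → HoldsOpen m
    holds-owned : ∀ m → HoldsOwned m

    holds-open zero F = holds-short 3 F
    holds-open (suc m) = holds-open-step {m} (holds-open m) (holds-owned m)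

    holds-owned zero {g = g} F g-bob =
      bob-completes 4 (3 + g) F ExtendsUpTo-refl three (≤-offset 3 4)
        λ cl → λ { zero                   → by-left (Claims.persists cl three g-bob)
                 ; (suc zero)             → by-right (Claims.claimed cl)
                 ; (suc (suc zero))       → by-self (Claims.claimed cl)
                 ; (suc (suc (suc zero))) → by-left (Claims.claimed cl) }
      where three = Suffix.ahead (Frontier.suffix F) 3
    holds-owned (suc m) = holds-owned-step {m} (holds-open m) (holds-owned m)

module BoundedPath (n : ℕ) where

  open PathGame (n + 4) public
  open Race (n + 2) (trans (+-suc n 3) (cong suc (+-suc n 2))) public

  start : Config (n + 4)
  start = boundedPath A n A

  start-cell : ∀ {i} → i < n + 4 → cell start i ≡ boundedCell A n A i
  start-cell {i} i<N with i <? n + 4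
  ... | yes p = cong (boundedCell A n A) (toℕ-fromℕ< p)
  ... | no ¬p = ⊥-elim (¬p i<N)

  <n+4 : ∀ {i} → i ≤ 3 + n → i < n + 4
  <n+4 {i} i≤ = subst (i <_) (+-comm 4 n) (s≤s i≤)

  first-cell-bob : cell start 0 ≡ own B
  first-cell-bob = start-cell (<n+4 z≤n)

  last-cell-bob : cell start (suc (n + 2)) ≡ own B
  last-cell-bob rewrite +-comm n 2 = trans (start-cell (<n+4 ≤-refl)) bob-at-end
    where
    bob-at-end : boundedCell A n A (3 + n) ≡ own B
    bob-at-end rewrite dec-false (suc n ≟ n) 1+n≢n | dec-true (n ≟ n) refl = refl

  inner-cells-free : ∀ {i} → 1 < i → i < n + 2 → cell start i ≡ free
  inner-cells-free {suc (suc j)} (s≤s (s≤s _)) i<n+2 =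
    trans (start-cell (<n+4 (s≤s (s≤s (≤-trans (<⇒≤ j<n) (n≤1+n n)))))) free-inside
    where
    j<n : j < n
    j<n = ≤-pred (≤-pred (subst (3 + j ≤_) (+-comm n 2) i<n+2))
    free-inside : boundedCell A n A (2 + j) ≡ free
    free-inside rewrite dec-false (j ≟ n) (<⇒≢ j<n) | dec-false (j ≟ suc n) (<⇒≢ (≤-trans j<n (n≤1+n n)))
      = refl

  initial-Frontier : Frontier start 1 n
  initial-Frontier = record
    { suffix    = record { length = sym (+-suc n 1) ; last-bob = last-cell-bob ; free-ahead = inner-cells-free }
    ; dominated = λ { z≤n → by-self first-cell-bob ; (s≤s z≤n) → by-left first-cell-bob } }

lemma14 : (k : ℕ) → 1 ≤ k →
    ¬ AliceWins (pathGraph (3 * k + 4)) (boundedPath A (3 * k) A) B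
lemma14 (suc k) _ = holds-open k (subst (Frontier start 1) (*-comm 3 (suc k)) initial-Frontier)
  where
  open BoundedPath (3 * suc k)
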